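{- Let $\mathtt{CA}$ be a protocol solving binary Commit-Adopt against a stationary $t$-MAd adversary of type send-omission (respectively, authenticated Byzantine). Then the following protocol $\mathtt{StatCons}$ solves binary consensus against a stationary $t$-MAd adversary of the same type. Each $p_j$ with input $x_j$ sets $temp_j:=x_j$. For $i=1,\dots,n$: (1) the processors execute $\mathtt{CA}$ with inputs $temp_1,\dots,temp_n$, and $p_j$ obtains output $y_j\in\{commit(b_j),adopt(b_j)\}$; (2) $p_i$ sends $b_i$ to every $p_j$, who denotes the received value $b_{i\to j}$; (3) each $p_j$ sets $temp_j:=b_j$ if $y_j=commit(b_j)$ and $temp_j:=b_{i\to j}$ otherwise. Finally every processor $p_j$ outputs $temp_j$.
   Context: System: $n$ processors $p_1,\dots,p_n$ run a synchronous protocol in rounds; in each round every processor sends a (possibly different) message to every processor over a dedicated point-to-point channel whose receiver knows which processor the channel comes from; messages sent in round $\rho$ are delivered by the start of round $\rho+1$. A message adversary (MAd) sees all messages and, in each round, may act only on outgoing messages of processors it corrupts; it never alters internal states, inputs, outputs or incoming messages. Every processor (corrupted or not) must output and the task conditions apply to all processors. Send-omission: the adversary may delete any messages sent by a corrupted processor. Authenticated Byzantine: it may delete or arbitrarily replace messages sent by a processor corrupted in that round, but every message has the form $(p_i,\rho,m)$ and for every message $(p,\rho,m)$ sent and every $(p',\rho',m')$ with $\rho'\le\rho$ encoded as a substring of $m$, either $p'$ was corrupted in round $\rho'$ or $p'$ was uncorrupted then and actually sent $(p',\rho',m')$. A stationary $t$-MAd adversary corrupts at most $t$ processors in total throughout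 the execution. Binary consensus: each processor has an input bit and outputs a bit; every output equals some processor's input, and no two processors output different bits. Binary Commit-Adopt: each processor has an input bit and outputs $commit(v)$ or $adopt(v)$ with $v$ some processor's input; if all inputs equal $v$ all output $commit(v)$; if some processor outputs $commit(v)$ then every processor outputs $commit(v)$ or $adopt(v)$. -}

module Defs where

open import Data.Nat using (ℕ; zero; suc; _+_; _*_; _∸_; _≤_; _<_; _≤ᵇ_; _<ᵇ_; _≡ᵇ_)
open import Data.Bool using (Bool; true; false; if_then_else_)
open import Data.Fin using (Fin; toℕ) renaming (zero to fzero; suc to fsuc)
open import Data.Fin.Subset using (Subset; _∈_; _∉_; _⊆_; ∣_∣)
open import Data.List using (List; []; _∷_)
open import Data.Maybe using (Maybe; just; nothing; _>>=_)
open import Data.Product using (Σ; ∃; _×_; _,_)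
open import Data.Sum using (_⊎_)
open import Relation.Binary.PropositionalEquality using (_≡_)

-- A message is a triple (p , ρ , m); the content m is a list
-- of items, each an atom (a natural number) or an encoded message.
-- "(p',ρ',m') encoded as a substring of m" = occurs nested in m.

data Msg (n : ℕ) : Set
data Item (n : ℕ) : Set

data Msg n where
  ⟨_,_,_⟩ : Fin n → ℕ → List (Item n) → Msg n

data Item n where
  nat : ℕ → Item n
  sub : Msg n → Item n

Content : ℕ → Set
Content n = List (Item n)

data _≺_ {n : ℕ} (m : Msg n) : Content n → Set where
  here   : ∀ {c} → m ≺ (sub m ∷ c)
  inside : ∀ {p ρ c′ c} → m ≺ c′ → m ≺ (sub ⟨ p , ρ , c′ ⟩ ∷ c)
  there  : ∀ {i c} → m ≺ c → m ≺ (i ∷ c)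

-- In round ρ = suc r processor p (in state s after r rounds) sends to q
-- the message ⟨ p , ρ , send p s q ⟩ ; it then receives, from each q,
-- either nothing (deleted) or a message, and updates its state.

record Protocol (n : ℕ) (I O : Set) : Set₁ where
  field
    State  : Set
    rounds : ℕ
    init   : Fin n → I → State
    send   : Fin n → State → Fin n → Content n
    step   : Fin n → State → (Fin n → Maybe (Msg n)) → State
    out    : Fin n → State → O

-- D ρ p q : what is delivered to q on the channel from p in round ρ
Delivery : ℕ → Set
Delivery n = ℕ → Fin n → Fin n → Maybe (Msg n)

module Run {n : ℕ} {I O : Set} (P : Protocol n I O)
           (x : Fin n → I) (D : Delivery n) where
  open Protocol P

  states : ℕ → Fin n → State
  states zero    p = init p (x p)
  states (suc r) p = step p (states r p) (λ q → D (suc r) q p)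

  sent : ℕ → Fin n → Fin n → Msg n
  sent r p q = ⟨ p , suc r , send p (states r p) q ⟩

  ActuallySent : Fin n → ℕ → Content n → Set
  ActuallySent p ρ c =
    Σ ℕ λ r → ρ ≡ suc r × r < rounds × Σ (Fin n) λ q → send p (states r p) q ≡ c

  outputs : Fin n → O
  outputs p = out p (states rounds p)

-- Stationary t-MAd adversaries: corr ρ is the set corrupted in round ρ;
-- all of them lie in a fixed set S of at most t processors.

record Corruption (n t : ℕ) : Set where
  field
    S      : Subset n
    bound  : ∣ S ∣ ≤ t
    corr   : ℕ → Subset n
    within : ∀ ρ → corr ρ ⊆ S

data AdvType : Set where
  sendOmission authByzantine : AdvType

module _ {n : ℕ} {I O : Set} (P : Protocol n I O) where
  open Protocol P

  Authentic : (x : Fin n → I) (D : Delivery n) {t : ℕ} → Corruption n t →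
              ℕ → Fin n → Msg n → Set
  Authentic x D C r p ⟨ p′ , ρ , c ⟩ =
    p′ ≡ p × ρ ≡ suc r ×
    (∀ p″ ρ″ c″ → ⟨ p″ , ρ″ , c″ ⟩ ≺ c → ρ″ ≤ suc r →
       (p″ ∈ Corruption.corr C ρ″)
       ⊎ (p″ ∉ Corruption.corr C ρ″ × Run.ActuallySent P x D p″ ρ″ c″))

  Admissible : AdvType → (x : Fin n → I) (D : Delivery n) {t : ℕ} →
               Corruption n t → Set
  Admissible sendOmission x D C =
    ∀ r → r < rounds → ∀ p q →
      (p ∉ Corruption.corr C (suc r) → D (suc r) p q ≡ just (Run.sent P x D r p q))
      × (D (suc r) p q ≡ nothing ⊎ D (suc r) p q ≡ just (Run.sent P x D r p q))
  Admissible authByzantine x D C =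
    ∀ r → r < rounds → ∀ p q →
      (p ∉ Corruption.corr C (suc r) → D (suc r) p q ≡ just (Run.sent P x D r p q))
      × (p ∈ Corruption.corr C (suc r) →
           ∀ m → D (suc r) p q ≡ just m → Authentic x D C r p m)

Task : ℕ → Set → Set → Set₁
Task n I O = (Fin n → I) → (Fin n → O) → Set

Solves : {n : ℕ} {I O : Set} → AdvType → (t : ℕ) → Protocol n I O → Task n I O → Set
Solves {n} ty t P T =
  ∀ (x : Fin n → _) (C : Corruption n t) (D : Delivery n) →
    Admissible P ty x D C → T x (Run.outputs P x D)

data CAOut : Set where
  commit adopt : Bool → CAOut

val : CAOut → Bool
val (commit b) = b
val (adopt b)  = b

CommitAdopt : (n : ℕ) → Task n Bool CAOut
CommitAdopt n x y =
  (∀ p → ∃ λ q → val (y p) ≡ x q)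
  × (∀ v → (∀ p → x p ≡ v) → ∀ p → y p ≡ commit v)
  × (∀ p v → y p ≡ commit v → ∀ q → (y q ≡ commit v) ⊎ (y q ≡ adopt v))

Consensus : (n : ℕ) → Task n Bool Bool
Consensus n x y = (∀ p → ∃ λ q → y p ≡ x q) × (∀ p q → y p ≡ y q)

-- Running CA as a subroutine starting after global round o:
-- local round ℓ ≥ 1 is global round o + ℓ. Round numbers inside
-- messages are translated (local 0 stays 0); incoming messages whose
-- round numbers are not in the image of the translation are discarded.

trOutH : ℕ → ℕ → ℕ
trOutH o zero    = zero
trOutH o (suc l) = o + suc l

trOutM : {n : ℕ} → ℕ → Msg n → Msg n
trOutC : {n : ℕ} → ℕ → Content n → Content n
trOutM o ⟨ p , ρ , c ⟩ = ⟨ p , trOutH o ρ , trOutC o c ⟩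
trOutC o []            = []
trOutC o (nat k ∷ c)   = nat k ∷ trOutC o c
trOutC o (sub m ∷ c)   = sub (trOutM o m) ∷ trOutC o c

trInH : ℕ → ℕ → Maybe ℕ
trInH o zero    = just zero
trInH o (suc r) = if o ≤ᵇ r then just (suc r ∸ o) else nothing

trInM : {n : ℕ} → ℕ → Msg n → Maybe (Msg n)
trInC : {n : ℕ} → ℕ → Content n → Maybe (Content n)
trInM o ⟨ p , ρ , c ⟩ =
  trInH o ρ >>= λ ρ′ → trInC o c >>= λ c′ → just ⟨ p , ρ′ , c′ ⟩
trInC o []          = just []
trInC o (nat k ∷ c) = trInC o c >>= λ c′ → just (nat k ∷ c′)
trInC o (sub m ∷ c) = trInM o m >>= λ m′ → trInC o c >>= λ c′ → just (sub m′ ∷ c′)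

lookupℕ : {n : ℕ} {A : Set} → (Fin n → A) → ℕ → Maybe A
lookupℕ {zero}  f i       = nothing
lookupℕ {suc n} f zero    = just (f fzero)
lookupℕ {suc n} f (suc i) = lookupℕ (λ q → f (fsuc q)) i

bitℕ : Bool → ℕ
bitℕ false = 0
bitℕ true  = 1

-- b_{i→j}; if nothing (well-formed) was received, keep the default
decodeBit : {n : ℕ} → Bool → Maybe (Maybe (Msg n)) → Bool
decodeBit d (just (just ⟨ _ , _ , nat 0 ∷ [] ⟩)) = false
decodeBit d (just (just ⟨ _ , _ , nat 1 ∷ [] ⟩)) = true
decodeBit d _                                    = d

newTemp : {n : ℕ} → CAOut → Maybe (Maybe (Msg n)) → Bool
newTemp (commit b) _ = b
newTemp (adopt b)  m = decodeBit b m

-- StatCons.  Iteration i (0-based, i < n) occupies global rounds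
-- i*(R+1)+1 … (i+1)*(R+1): R rounds of CA, then one round in which the
-- processor with index i sends b_i to everybody.

record SCState (S : Set) : Set where
  constructor mkSC
  field
    iter : ℕ
    pos  : ℕ
    temp : Bool
    ca   : S

module _ {n : ℕ} (CA : Protocol n Bool CAOut) where
  private
    module C = Protocol CA
    R = C.rounds

  scSend : Fin n → SCState C.State → Fin n → Content n
  scSend p (mkSC i k tmp st) q =
    if k <ᵇ R then trOutC (i * suc R) (C.send p st q)
    else (if toℕ p ≡ᵇ i then nat (bitℕ (val (C.out p st))) ∷ [] else [])

  scStep : Fin n → SCState C.State → (Fin n → Maybe (Msg n)) → SCState C.State
  scStep p (mkSC i k tmp st) inc =
    if k <ᵇ R
    then mkSC i (suc k) tmp (C.step p st (λ q → inc q >>= trInM (i * suc R)))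
    else mkSC (suc i) 0 (newTemp (C.out p st) (lookupℕ inc i))
                        (C.init p (newTemp (C.out p st) (lookupℕ inc i)))

  StatCons : Protocol n Bool Bool
  StatCons = record
    { State  = SCState C.State
    ; rounds = n * suc R
    ; init   = λ p b → mkSC 0 0 b (C.init p b)
    ; send   = scSend
    ; step   = scStep
    ; out    = λ p s → SCState.temp s
    }

module Submission where

-- Iteration i of StatCons runs CA on the current temp values; after the round numbers inside
-- messages are translated back, the adversary's behaviour in that iteration is admissible for
-- CA, so every iteration solves Commit-Adopt. If temp is unanimous, CA commits everybody to
-- the common value, so unanimity persists; this gives validity. For agreement take a
-- processor p_i that is never corrupted: in iteration i everybody receives b_i, and a
-- processor that commits in that iteration commits to b_i as well, so temp becomes unanimous.
-- If every processor may be corrupted, silencing all of them shows that CA is unsolvable as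
-- soon as n ≥ 2.

open import Defs
open import Data.Nat using (ℕ; zero; suc; _+_; _*_; _∸_; _≤_; _<_; _≤ᵇ_; _<ᵇ_; _≡ᵇ_; z≤n; s≤s)
open import Data.Nat.Properties
open import Data.Bool using (Bool; true; false; T; not; if_then_else_)
import Data.Bool.Properties as Bool
open import Data.Empty using (⊥; ⊥-elim)
open import Data.Fin using (Fin; toℕ) renaming (zero to fzero; suc to fsuc)
open import Data.Fin.Properties using (toℕ<n; any?)
open import Data.Fin.Subset using (Subset; _∈_; _∉_; _⊆_)
open import Data.Fin.Subset.Properties using (_∈?_)
open import Data.List using ([]; _∷_)
open import Data.Maybe using (Maybe; just; nothing; _>>=_)
open import Data.Maybe.Properties using (just-injective)
open import Data.Product using (∃; _×_; _,_; proj₁; proj₂)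
open import Data.Sum using (_⊎_; inj₁; inj₂)
open import Relation.Binary.PropositionalEquality
open import Relation.Nullary using (¬_; yes; no; ¬?)
open import Relation.Nullary.Decidable using (decidable-stable)
open import Function using (case_of_)

>>=-just : ∀ {A B : Set} {m : Maybe A} {a : A} (f : A → Maybe B) → m ≡ just a → (m >>= f) ≡ f a
>>=-just f refl = refl

if-T : ∀ {A : Set} {b : Bool} {u v : A} → T b → (if b then u else v) ≡ u
if-T {b = true} _ = refl

if-¬T : ∀ {A : Set} {b : Bool} {u v : A} → ¬ T b → (if b then u else v) ≡ v
if-¬T {b = false} _ = refl
if-¬T {b = true}  ¬t = ⊥-elim (¬t _)

trInH∘trOutH : ∀ o ρ → trInH o (trOutH o ρ) ≡ just ρ
trInH∘trOutH o zero = refl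
trInH∘trOutH o (suc l) rewrite +-suc o l =
  trans (if-T (≤⇒≤ᵇ (m≤m+n o l))) (cong just (trans (cong (_∸ o) (sym (+-suc o l))) (m+n∸m≡n o (suc l))))

trInM∘trOutM : ∀ {n} o (m : Msg n) → trInM o (trOutM o m) ≡ just m
trInC∘trOutC : ∀ {n} o (c : Content n) → trInC o (trOutC o c) ≡ just c
trInM∘trOutM o ⟨ p , ρ , c ⟩ =
  trans (>>=-just _ (trInH∘trOutH o ρ)) (>>=-just (λ c′ → just ⟨ p , ρ , c′ ⟩) (trInC∘trOutC o c))
trInC∘trOutC o [] = refl
trInC∘trOutC o (nat k ∷ c) = >>=-just (λ c′ → just (nat k ∷ c′)) (trInC∘trOutC o c)
trInC∘trOutC o (sub m ∷ c) =
  trans (>>=-just _ (trInM∘trOutM o m)) (>>=-just (λ c′ → just (sub m ∷ c′)) (trInC∘trOutC o c))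

trOutH-injective : ∀ o {ρ ρ′} → trOutH o ρ ≡ trOutH o ρ′ → ρ ≡ ρ′
trOutH-injective o {ρ} {ρ′} e =
  just-injective (trans (sym (trInH∘trOutH o ρ)) (trans (cong (trInH o) e) (trInH∘trOutH o ρ′)))

trOutC-injective : ∀ {n} o {c c′ : Content n} → trOutC o c ≡ trOutC o c′ → c ≡ c′
trOutC-injective o {c} {c′} e =
  just-injective (trans (sym (trInC∘trOutC o c)) (trans (cong (trInC o) e) (trInC∘trOutC o c′)))

trInH-just : ∀ o ρ {ρ′} → trInH o ρ ≡ just ρ′ → trOutH o ρ′ ≡ ρ
trInH-just o zero refl = refl
trInH-just o (suc r) e with o ≤ᵇ r in o≤ᵇr
trInH-just o (suc r) refl | true = begin
  trOutH o (suc r ∸ o)   ≡⟨ cong (trOutH o) (+-∸-assoc 1 o≤r) ⟩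
  o + suc (r ∸ o)        ≡⟨ +-suc o (r ∸ o) ⟩
  suc (o + (r ∸ o))      ≡⟨ cong suc (m+[n∸m]≡n o≤r) ⟩
  suc r                  ∎
  where
  open ≡-Reasoning
  o≤r : o ≤ r
  o≤r = ≤ᵇ⇒≤ o r (subst T (sym o≤ᵇr) _)

trInM-just : ∀ {n} o (m : Msg n) {m′} → trInM o m ≡ just m′ → trOutM o m′ ≡ m
trInC-just : ∀ {n} o (c : Content n) {c′} → trInC o c ≡ just c′ → trOutC o c′ ≡ c
trInM-just o ⟨ p , ρ , c ⟩ e with trInH o ρ in eρ | trInC o c in ec
trInM-just o ⟨ p , ρ , c ⟩ refl | just ρ′ | just c′ =
  cong₂ (λ ρ c → ⟨ p , ρ , c ⟩) (trInH-just o ρ eρ) (trInC-just o c ec)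
trInC-just o [] refl = refl
trInC-just o (nat k ∷ c) e with trInC o c in ec
trInC-just o (nat k ∷ c) refl | just c′ = cong (nat k ∷_) (trInC-just o c ec)
trInC-just o (sub m ∷ c) e with trInM o m in em | trInC o c in ec
trInC-just o (sub m ∷ c) refl | just m′ | just c′ =
  cong₂ (λ m c → sub m ∷ c) (trInM-just o m em) (trInC-just o c ec)

≺-trOut : ∀ {n} o {m : Msg n} {c} → m ≺ c → trOutM o m ≺ trOutC o c
≺-trOut o here = here
≺-trOut o (inside m≺c) = inside (≺-trOut o m≺c)
≺-trOut o (there {nat k} m≺c) = there (≺-trOut o m≺c)
≺-trOut o (there {sub m} m≺c) = there (≺-trOut o m≺c)

unanimity⇒validity : ∀ {n} (x : Fin n → Bool) b →
  (∀ v → (∀ q → x q ≡ v) → b ≡ v) → ∃ λ q → b ≡ x q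
unanimity⇒validity x b unanimity with any? (λ q → b Bool.≟ x q)
... | yes found = found
... | no none = ⊥-elim (Bool.not-¬ refl (unanimity (not b) (λ q → Bool.¬-not (λ e → none (q , sym e)))))

silence : ∀ {n} → Delivery n
silence _ _ _ = nothing

silent-states-local : ∀ {n I O} (P : Protocol n I O) {x x′ : Fin n → I} p → x p ≡ x′ p →
  ∀ r → Run.states P x silence r p ≡ Run.states P x′ silence r p
silent-states-local P p e zero = cong (Protocol.init P p) e
silent-states-local P p e (suc r) =
  cong (λ s → Protocol.step P p s (λ _ → nothing)) (silent-states-local P p e r)

module _ {n t : ℕ} (C : Corruption n t) (allCorruptible : ∀ p → p ∈ Corruption.S C) where
  open Corruption C

  silencing : Corruption n t
  silencing = record { S = S ; bound = bound ; corr = λ _ → S ; within = λ _ p∈S → p∈S }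

  silencing-admissible : ∀ {I O} ty (P : Protocol n I O) x → Admissible P ty x silence silencing
  silencing-admissible sendOmission  P x _ _ p _ = (λ p∉S → ⊥-elim (p∉S (allCorruptible p))) , inj₁ refl
  silencing-admissible authByzantine P x _ _ p _ = (λ p∉S → ⊥-elim (p∉S (allCorruptible p))) , λ _ _ ()

-- Under silence a processor's output depends only on its own input, so with inputs
-- false, true, true, … processors 0 and 1 commit to their own, different, inputs.
at-most-one-processor : ∀ {n t} ty (CA : Protocol n Bool CAOut) → Solves ty t CA (CommitAdopt n) →
  (C : Corruption n t) → (∀ p → p ∈ Corruption.S C) → (p q : Fin n) → p ≡ q
at-most-one-processor {suc zero} _ _ _ _ _ fzero fzero = refl
at-most-one-processor {suc (suc m)} ty CA solves C allCorruptible _ _ = ⊥-elim split-brain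
  where
  open Protocol CA
  run : ∀ x → CommitAdopt (suc (suc m)) x (Run.outputs CA x silence)
  run x = solves x (silencing C allCorruptible) silence (silencing-admissible C allCorruptible ty CA x)

  mixed : Fin (suc (suc m)) → Bool
  mixed fzero    = false
  mixed (fsuc _) = true

  commits-own-input : ∀ p → Run.outputs CA mixed silence p ≡ commit (mixed p)
  commits-own-input p =
    trans (cong (out p) (silent-states-local CA p refl rounds))
          (proj₁ (proj₂ (run (λ _ → mixed p))) (mixed p) (λ _ → refl) p)

  split-brain : ⊥
  split-brain with proj₂ (proj₂ (run mixed)) fzero false (commits-own-input fzero) (fsuc fzero)
  ... | inj₁ e = case trans (sym (commits-own-input (fsuc fzero))) e of λ ()
  ... | inj₂ e = case trans (sym (commits-own-input (fsuc fzero))) e of λ ()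

lookupℕ-toℕ : ∀ {m} {A : Set} (f : Fin m → A) (q : Fin m) → lookupℕ f (toℕ q) ≡ just (f q)
lookupℕ-toℕ f fzero    = refl
lookupℕ-toℕ f (fsuc q) = lookupℕ-toℕ (λ z → f (fsuc z)) q

newTemp-bitℕ : ∀ {n} y v (p : Fin n) ρ → (∀ b → y ≡ commit b → b ≡ v) →
  newTemp y (just (just ⟨ p , ρ , nat (bitℕ v) ∷ [] ⟩)) ≡ v
newTemp-bitℕ (commit b) v     p ρ commit⇒v = commit⇒v b refl
newTemp-bitℕ (adopt b)  false p ρ _        = refl
newTemp-bitℕ (adopt b)  true  p ρ _        = refl

module Iterations {n : ℕ} (CA : Protocol n Bool CAOut) (x : Fin n → Bool) (D : Delivery n) where
  open Protocol CA

  R : ℕ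
  R = rounds

  SC : Protocol n Bool Bool
  SC = StatCons CA

  start : ℕ → ℕ
  start i = i * suc R

  scState : ℕ → Fin n → SCState State
  scState = Run.states SC x D

  tempAt : ℕ → Fin n → Bool
  tempAt i p = SCState.temp (scState (start i) p)

  caDelivery : ℕ → Delivery n
  caDelivery i zero    _ _ = nothing
  caDelivery i (suc l) q p = D (suc (start i + l)) q p >>= trInM (start i)

  caState : ℕ → ℕ → Fin n → State
  caState i = Run.states CA (tempAt i) (caDelivery i)

  caOutput : ℕ → Fin n → CAOut
  caOutput i = Run.outputs CA (tempAt i) (caDelivery i)

  broadcastReceived : ℕ → Fin n → Maybe (Maybe (Msg n))
  broadcastReceived i p = lookupℕ (λ q → D (suc (start i + R)) q p) i

  nextTemp : ℕ → Fin n → Bool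
  nextTemp i p = newTemp (caOutput i p) (broadcastReceived i p)

  R≮ᵇR : ¬ T (R <ᵇ R)
  R≮ᵇR R<R = <-irrefl refl (<ᵇ⇒< R R R<R)

  scStep-during : ∀ p i l tmp s inc → l < R →
    scStep CA p (mkSC i l tmp s) inc ≡ mkSC i (suc l) tmp (step p s (λ q → inc q >>= trInM (start i)))
  scStep-during p i l tmp s inc l<R = if-T (<⇒<ᵇ l<R)

  scStep-last : ∀ p i tmp s inc →
    scStep CA p (mkSC i R tmp s) inc ≡
      mkSC (suc i) 0 (newTemp (out p s) (lookupℕ inc i)) (init p (newTemp (out p s) (lookupℕ inc i)))
  scStep-last p i tmp s inc = if-¬T R≮ᵇR

  scState-start : ∀ i p → scState (start i) p ≡ mkSC i 0 (tempAt i p) (init p (tempAt i p))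
  scState-during : ∀ i l p → l ≤ R → scState (start i + l) p ≡ mkSC i l (tempAt i p) (caState i l p)
  scState-next : ∀ i p → scState (start (suc i)) p ≡ mkSC (suc i) 0 (nextTemp i p) (init p (nextTemp i p))

  scState-next i p = begin
    scState (suc R + start i) p
      ≡⟨ cong (λ r → scState r p) (cong suc (+-comm R (start i))) ⟩
    scStep CA p (scState (start i + R) p) (λ q → D (suc (start i + R)) q p)
      ≡⟨ cong (λ s → scStep CA p s (λ q → D (suc (start i + R)) q p)) (scState-during i R p ≤-refl) ⟩
    scStep CA p (mkSC i R (tempAt i p) (caState i R p)) (λ q → D (suc (start i + R)) q p)
      ≡⟨ scStep-last p i _ _ _ ⟩
    mkSC (suc i) 0 (nextTemp i p) (init p (nextTemp i p)) ∎
    where open ≡-Reasoning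

  tempAt-suc : ∀ i p → tempAt (suc i) p ≡ nextTemp i p
  tempAt-suc i p = cong SCState.temp (scState-next i p)

  scState-start zero    p = refl
  scState-start (suc i) p =
    trans (scState-next i p) (cong (λ b → mkSC (suc i) 0 b (init p b)) (sym (tempAt-suc i p)))

  scState-during i zero p _ = trans (cong (λ r → scState r p) (+-identityʳ (start i))) (scState-start i p)
  scState-during i (suc l) p l<R = begin
    scState (start i + suc l) p
      ≡⟨ cong (λ r → scState r p) (+-suc (start i) l) ⟩
    scStep CA p (scState (start i + l) p) (λ q → D (suc (start i + l)) q p)
      ≡⟨ cong (λ s → scStep CA p s (λ q → D (suc (start i + l)) q p)) (scState-during i l p (<⇒≤ l<R)) ⟩
    scStep CA p (mkSC i l (tempAt i p) (caState i l p)) (λ q → D (suc (start i + l)) q p)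
      ≡⟨ scStep-during p i l _ _ _ l<R ⟩
    mkSC i (suc l) (tempAt i p) (caState i (suc l) p) ∎
    where open ≡-Reasoning

  scSend-during : ∀ i l p q → l < R →
    scSend CA p (scState (start i + l) p) q ≡ trOutC (start i) (send p (caState i l p) q)
  scSend-during i l p q l<R =
    trans (cong (λ s → scSend CA p s q) (scState-during i l p (<⇒≤ l<R))) (if-T (<⇒<ᵇ l<R))

  scSend-leader : ∀ i p q → toℕ p ≡ i →
    scSend CA p (scState (start i + R) p) q ≡ nat (bitℕ (val (caOutput i p))) ∷ []
  scSend-leader i p q p≡i = begin
    scSend CA p (scState (start i + R) p) q
      ≡⟨ cong (λ s → scSend CA p s q) (scState-during i R p ≤-refl) ⟩
    scSend CA p (mkSC i R (tempAt i p) (caState i R p)) q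
      ≡⟨ if-¬T R≮ᵇR ⟩
    (if toℕ p ≡ᵇ i then nat (bitℕ (val (caOutput i p))) ∷ [] else [])
      ≡⟨ if-T (≡⇒≡ᵇ (toℕ p) i p≡i) ⟩
    nat (bitℕ (val (caOutput i p))) ∷ [] ∎
    where open ≡-Reasoning

  start+l<rounds : ∀ {i l} → i < n → l < suc R → start i + l < n * suc R
  start+l<rounds {i} i<n l<1+R = ≤-trans (+-monoʳ-< (start i) l<1+R)
    (≤-trans (≤-reflexive (+-comm (start i) (suc R))) (*-monoˡ-≤ (suc R) i<n))

  module _ {t : ℕ} (C : Corruption n t) where
    open Corruption C

    honest-delivery : ∀ ty → Admissible SC ty x D C → ∀ r → r < n * suc R → ∀ p q →
      p ∉ corr (suc r) → D (suc r) p q ≡ just (Run.sent SC x D r p q)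
    honest-delivery sendOmission  adm r r<rounds p q = proj₁ (adm r r<rounds p q)
    honest-delivery authByzantine adm r r<rounds p q = proj₁ (adm r r<rounds p q)

    iterationCorruption : ℕ → Corruption n t
    iterationCorruption i = record { S = S ; bound = bound ; corr = corrᵢ ; within = withinᵢ }
      where
      corrᵢ : ℕ → Subset n
      corrᵢ zero    = corr 0
      corrᵢ (suc l) = corr (suc (start i + l))
      withinᵢ : ∀ ρ → corrᵢ ρ ⊆ S
      withinᵢ zero    = within 0
      withinᵢ (suc l) = within (suc (start i + l))

    caDelivery-sent : ∀ i l p q → l < R →
      D (suc (start i + l)) p q ≡ just (Run.sent SC x D (start i + l) p q) →
      caDelivery i (suc l) p q ≡ just (Run.sent CA (tempAt i) (caDelivery i) l p q)
    caDelivery-sent i l p q l<R delivered = begin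
      caDelivery i (suc l) p q
        ≡⟨ >>=-just (trInM (start i)) delivered ⟩
      trInM (start i) ⟨ p , suc (start i + l) , scSend CA p (scState (start i + l) p) q ⟩
        ≡⟨ cong (λ c → trInM (start i) ⟨ p , suc (start i + l) , c ⟩) (scSend-during i l p q l<R) ⟩
      trInM (start i) ⟨ p , suc (start i + l) , trOutC (start i) c ⟩
        ≡⟨ subst (λ ρ → trInM (start i) ⟨ p , ρ , trOutC (start i) c ⟩ ≡ just ⟨ p , suc l , c ⟩)
                 (+-suc (start i) l) (trInM∘trOutM (start i) ⟨ p , suc l , c ⟩) ⟩
      just ⟨ p , suc l , c ⟩ ∎
      where
      open ≡-Reasoning
      c : Content n
      c = send p (caState i l p) q

    -- A message relayed inside a simulated CA message occurs, with its round number translated,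
    -- inside the real message, where the real authenticity guarantee covers it.
    relayed-translated : ∀ i l c → l < R →
      (∀ p″ ρ″ c″ → ⟨ p″ , ρ″ , c″ ⟩ ≺ trOutC (start i) c → ρ″ ≤ suc (start i + l) →
         (p″ ∈ corr ρ″) ⊎ (p″ ∉ corr ρ″ × Run.ActuallySent SC x D p″ ρ″ c″)) →
      (∀ p″ ρ″ c″ → ⟨ p″ , ρ″ , c″ ⟩ ≺ c → ρ″ ≤ suc l →
         (p″ ∈ Corruption.corr (iterationCorruption i) ρ″)
         ⊎ (p″ ∉ Corruption.corr (iterationCorruption i) ρ″
            × Run.ActuallySent CA (tempAt i) (caDelivery i) p″ ρ″ c″))
    relayed-translated i l c l<R relayed p″ zero c″ m≺c _
      with relayed p″ 0 (trOutC (start i) c″) (≺-trOut (start i) m≺c) z≤n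
    ... | inj₁ p″∈ = inj₁ p″∈
    ... | inj₂ (_ , _ , () , _)
    relayed-translated i l c l<R relayed p″ (suc k) c″ m≺c k<l
      with relayed p″ (suc (start i + k)) (trOutC (start i) c″)
             (subst (λ ρ → ⟨ p″ , ρ , trOutC (start i) c″ ⟩ ≺ trOutC (start i) c)
                    (+-suc (start i) k) (≺-trOut (start i) m≺c))
             (s≤s (+-monoʳ-≤ (start i) (≤-pred k<l)))
    ... | inj₁ p″∈ = inj₁ p″∈
    ... | inj₂ (p″∉ , _ , refl , _ , q , sent) =
      inj₂ (p″∉ , k , refl , k<R , q , trOutC-injective (start i) (trans (sym (scSend-during i k p″ q k<R)) sent))
      where
      k<R : k < R
      k<R = ≤-<-trans (≤-pred k<l) l<R

    authentic-translated : ∀ i l p m → l < R →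
      Authentic SC x D C (start i + l) p (trOutM (start i) m) →
      Authentic CA (tempAt i) (caDelivery i) (iterationCorruption i) l p m
    authentic-translated i l p ⟨ p′ , ρ , c ⟩ l<R (p′≡p , round , relayed) =
      p′≡p , trOutH-injective (start i) (trans round (sym (+-suc (start i) l))) ,
      relayed-translated i l c l<R relayed

    caDelivery-honest : ∀ ty → Admissible SC ty x D C → ∀ i l p q → i < n → l < R →
      p ∉ corr (suc (start i + l)) →
      caDelivery i (suc l) p q ≡ just (Run.sent CA (tempAt i) (caDelivery i) l p q)
    caDelivery-honest ty adm i l p q i<n l<R p∉ =
      caDelivery-sent i l p q l<R (honest-delivery ty adm _ (start+l<rounds i<n (m<n⇒m<1+n l<R)) p q p∉)

    caDelivery-authentic : Admissible SC authByzantine x D C → ∀ i l p q → i < n → l < R →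
      p ∈ corr (suc (start i + l)) → ∀ m′ → caDelivery i (suc l) p q ≡ just m′ →
      Authentic CA (tempAt i) (caDelivery i) (iterationCorruption i) l p m′
    caDelivery-authentic adm i l p q i<n l<R p∈ m′ received with D (suc (start i + l)) p q in delivered
    ... | just m with refl ← trInM-just (start i) m received =
      authentic-translated i l p m′ l<R
        (proj₂ (adm (start i + l) (start+l<rounds i<n (m<n⇒m<1+n l<R)) p q) p∈ _ delivered)

    iteration-admissible : ∀ ty → Admissible SC ty x D C → ∀ i → i < n →
      Admissible CA ty (tempAt i) (caDelivery i) (iterationCorruption i)
    iteration-admissible sendOmission adm i i<n l l<R p q =
      caDelivery-honest sendOmission adm i l p q i<n l<R ,
      (case proj₂ (adm (start i + l) (start+l<rounds i<n (m<n⇒m<1+n l<R)) p q) of λ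
        { (inj₁ deleted)   → inj₁ (cong (_>>= trInM (start i)) deleted)
        ; (inj₂ delivered) → inj₂ (caDelivery-sent i l p q l<R delivered) })
    iteration-admissible authByzantine adm i i<n l l<R p q =
      caDelivery-honest authByzantine adm i l p q i<n l<R ,
      caDelivery-authentic adm i l p q i<n l<R

    module Consensus (ty : AdvType) (adm : Admissible SC ty x D C)
                     (solves : Solves ty t CA (CommitAdopt n)) where

      commitAdopt : ∀ i → i < n → CommitAdopt n (tempAt i) (caOutput i)
      commitAdopt i i<n = solves (tempAt i) (iterationCorruption i) (caDelivery i) (iteration-admissible ty adm i i<n)

      Unanimous : ℕ → Bool → Set
      Unanimous i v = ∀ p → tempAt i p ≡ v

      unanimity-preserved : ∀ {i v} → i < n → Unanimous i v → Unanimous (suc i) v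
      unanimity-preserved {i} {v} i<n unanimous p = begin
        tempAt (suc i) p ≡⟨ tempAt-suc i p ⟩
        nextTemp i p     ≡⟨ cong (λ y → newTemp y (broadcastReceived i p)) (proj₁ (proj₂ (commitAdopt i i<n)) v unanimous p) ⟩
        v                ∎
        where open ≡-Reasoning

      unanimity-persists : ∀ {i j v} → i ≤ j → j ≤ n → Unanimous i v → Unanimous j v
      unanimity-persists {j = zero} z≤n _ unanimous = unanimous
      unanimity-persists {i} {suc j} i≤1+j 1+j≤n unanimous with m≤n⇒m<n∨m≡n i≤1+j
      ... | inj₁ i<1+j = unanimity-preserved 1+j≤n (unanimity-persists (≤-pred i<1+j) (<⇒≤ 1+j≤n) unanimous)
      ... | inj₂ refl  = unanimous

      leader-unanimity : ∀ leader → leader ∉ S →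
        Unanimous (suc (toℕ leader)) (val (caOutput (toℕ leader) leader))
      leader-unanimity leader leader∉S p = begin
        tempAt (suc i) p                                        ≡⟨ tempAt-suc i p ⟩
        newTemp (caOutput i p) (broadcastReceived i p)
          ≡⟨ cong (newTemp (caOutput i p)) (trans (lookupℕ-toℕ _ leader) (cong just broadcast)) ⟩
        newTemp (caOutput i p) (just (just ⟨ leader , suc (start i + R) , nat (bitℕ v) ∷ [] ⟩))
          ≡⟨ newTemp-bitℕ (caOutput i p) v leader _ commit⇒v ⟩
        v                                                       ∎
        where
        open ≡-Reasoning
        i = toℕ leader
        v = val (caOutput i leader)
        broadcast : D (suc (start i + R)) leader p ≡ just ⟨ leader , suc (start i + R) , nat (bitℕ v) ∷ [] ⟩
        broadcast = trans (honest-delivery ty adm _ (start+l<rounds (toℕ<n leader) ≤-refl) leader p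
                                           (λ leader∈ → leader∉S (within _ leader∈)))
                          (cong (λ c → just ⟨ leader , _ , c ⟩) (scSend-leader i leader p refl))
        commit⇒v : ∀ b → caOutput i p ≡ commit b → b ≡ v
        commit⇒v b committed with proj₂ (proj₂ (commitAdopt i (toℕ<n leader))) p b committed leader
        ... | inj₁ e = cong val (sym e)
        ... | inj₂ e = cong val (sym e)

      validity : ∀ p → ∃ λ q → tempAt n p ≡ x q
      validity p = unanimity⇒validity x (tempAt n p)
        (λ v unanimous → unanimity-persists z≤n ≤-refl unanimous p)

      agreement : ∀ p q → tempAt n p ≡ tempAt n q
      agreement p q with any? (λ r → ¬? (r ∈? S))
      ... | yes (leader , leader∉S) =
        trans (unanimity-persists (toℕ<n leader) ≤-refl (leader-unanimity leader leader∉S) p)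
              (sym (unanimity-persists (toℕ<n leader) ≤-refl (leader-unanimity leader leader∉S) q))
      ... | no none = cong (tempAt n)
        (at-most-one-processor ty CA solves C (λ r → decidable-stable (r ∈? S) (λ r∉ → none (r , r∉))) p q)

corollary4p2 : (n t : ℕ) (ty : AdvType) (CA : Protocol n Bool CAOut) →
    Solves ty t CA (CommitAdopt n) →
    Solves ty t (StatCons CA) (Consensus n)
corollary4p2 n t ty CA solves x C D adm = validity , agreement
  where open Iterations.Consensus CA x D C ty adm solves
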